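{- (i) The property $P_2$ is hereditary. (ii) If $P$ is a hereditary property, then for every $(G,f)$ with $P(G,f)$ we have $P_2(G,f)$. In particular, for every $(G,f)\in\mathcal C$ such that $G$ has a perfect $f$-factor, $P_2(G,f)$ holds.
   Context: A graph is a pair $G=(V,E)$ with $V$ a nonempty set and $E\subseteq\{e\subseteq V: |e|=2\}$. $\mathit{CN}$ denotes the class of cardinals, $\mathit{ON}$ the class of ordinals. For $F\subseteq E$ and $x\in V$, $d_F(x)=|\{e\in F: x\in e\}|$. For $f\colon V\to\mathit{CN}$, an $f$-factor of $G$ is a set $F\subseteq E$ with $d_F(x)\le f(x)$ for all $x$; it is perfect if $d_F(x)=f(x)$ for all $x$. $\mathcal C$ is the class of all pairs $(G,f)$ with $G=(V,E)$ a graph, $f\colon V\to\mathit{CN}$, and $f(x)\le d_E(x)$ for all $x\in V$. For an edge $\{x,y\}\in E$, $G-\{x,y\}$ denotes $(V,E\setminus\{\{x,y\}\})$. For $x,y\in V$, $f_{x,y}(v)=f(v)-1$ if $v\in\{x,y\}$ and $1\le f(v)<\aleph_0$, and $f_{x,y}(v)=f(v)$ otherwise. A property $P$ is a formula with two free variables; $P(G,f)$ means $(G,f)\in\mathcal C$ and $(G,f)$ satisfies $P$. $P$ is hereditary if for every $(G,f)$ with $P(G,f)$ and every $x\in V(G)$ with $f(x)>0$ there is $y\in V(G)$ with $f(y)>0$, $\{x,y\}\in E(G)$ and $P(G-\{x,y\},f_{x,y})$. Obstructions (for $(G,f)\in\mathcal C$, $G=(V,E)$, by recursion on ordinals $\alpha$):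 $(G,f)$ is a $0$-obstruction if there is $x\in V$ with $f(x)>0$ such that $f(y)=0$ for all $y$ with $\{x,y\}\in E$. $(G,f)$ is an $\alpha$-obstruction if there is $x\in V$ with $f(x)>0$ such that (i) for every $y\in V$ with $\{x,y\}\in E$ and $f(y)>0$ there is an ordinal $\beta_y$ such that $(G-\{x,y\},f_{x,y})$ is a $\beta_y$-obstruction, and (ii) $\alpha=\sup\{\beta_y+1: \{x,y\}\in E,\ f(y)>0\}$. $P_2(G,f)$ is the property "$(G,f)\in\mathcal C$ and $(G,f)$ is not an $\alpha$-obstruction for any ordinal $\alpha$". -}

module Defs where

open import Data.Nat using (ℕ; zero; suc)
open import Data.Fin using (Fin)
open import Data.Bool using (Bool; true; false; _∧_; _∨_; not; T)
open import Data.Bool.Properties using (∧-comm; ∨-comm)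
open import Data.Empty using (⊥)
open import Data.Unit using (⊤)
open import Data.Product using (Σ; _×_; _,_; proj₁; proj₂)
open import Relation.Nullary using (¬_; Dec)
open import Relation.Nullary.Decidable using (⌊_⌋)
open import Relation.Binary.Definitions using (DecidableEquality)
open import Relation.Binary.PropositionalEquality using (_≡_; refl; cong₂; trans)
open import Function.Bundles using (_↔_; _↣_)

-- V is a nonempty set (a designated element witnesses this),
-- equipped with decidable equality (classically every set has one).
-- The edge set E ⊆ [V]^2 is represented by its characteristic function
-- on ordered pairs, which is symmetric and irreflexive, so that the
-- unordered pair {x,y} is an edge iff T (E x y).

record Graph : Set₁ where
  field
    V      : Set
    v₀     : V
    _≟_    : DecidableEquality V
    E      : V → V → Bool
    E-sym  : ∀ x y → E x y ≡ E y x
    E-irr  : ∀ x → E x x ≡ false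

open Graph public

-- neighbourhood of x along an edge relation: {e ∈ F : x ∈ e} is in
-- bijection with {y : {x,y} ∈ F}
Nbhd : {V : Set} → (V → V → Bool) → V → Set
Nbhd {V} F x = Σ V (λ y → T (F x y))

Infinite : Set → Set
Infinite A = ∀ (n : ℕ) → ¬ (A ↔ Fin n)

data Card : Set₁ where
  fin : ℕ → Card
  inf : (A : Set) → Infinite A → Card

⟦_⟧ : Card → Set
⟦ fin n ⟧     = Fin n
⟦ inf A _ ⟧   = A

_≤∣_∣ : Card → Set → Set
c ≤∣ S ∣ = ⟦ c ⟧ ↣ S

_=∣_∣ : Card → Set → Set
c =∣ S ∣ = ⟦ c ⟧ ↔ S

Pos : Card → Set
Pos (fin zero)    = ⊥
Pos (fin (suc n)) = ⊤
Pos (inf A i)     = ⊤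

dec1 : Card → Card
dec1 (fin zero)    = fin zero
dec1 (fin (suc n)) = fin n
dec1 (inf A i)     = inf A i

module _ (G : Graph) where
  private
    _==_ : V G → V G → Bool
    u == v = ⌊ (G ._≟_) u v ⌋

  isPair : V G → V G → V G → V G → Bool
  isPair x y u v = ((u == x) ∧ (v == y)) ∨ ((u == y) ∧ (v == x))

  isPair-sym : ∀ x y u v → isPair x y u v ≡ isPair x y v u
  isPair-sym x y u v =
    trans (cong₂ _∨_ (∧-comm (u == x) (v == y)) (∧-comm (u == y) (v == x)))
          (∨-comm ((v == y) ∧ (u == x)) ((v == x) ∧ (u == y)))

  removeE : V G → V G → V G → V G → Bool
  removeE x y u v = E G u v ∧ not (isPair x y u v)

  removeE-sym : ∀ x y u v → removeE x y u v ≡ removeE x y v u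
  removeE-sym x y u v = cong₂ (λ a b → a ∧ not b) (E-sym G u v) (isPair-sym x y u v)

  removeE-irr : ∀ x y u → removeE x y u u ≡ false
  removeE-irr x y u rewrite E-irr G u = refl

  _-edge_,_ : V G → V G → Graph
  _-edge_,_ x y = record
    { V = V G ; v₀ = v₀ G ; _≟_ = G ._≟_
    ; E = removeE x y ; E-sym = removeE-sym x y ; E-irr = removeE-irr x y }

  fxy : (V G → Card) → V G → V G → V G → Card
  fxy f x y v with (v == x) ∨ (v == y)
  ... | true  = dec1 (f v)
  ... | false = f v

InC : (G : Graph) → (V G → Card) → Set
InC G f = ∀ x → f x ≤∣ Nbhd (E G) x ∣

record PerfectFactor (G : Graph) (f : V G → Card) : Set where
  field
    F       : V G → V G → Bool
    F-sym   : ∀ x y → F x y ≡ F y x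
    F-sub   : ∀ x y → T (F x y) → T (E G x y)
    perfect : ∀ x → f x =∣ Nbhd F x ∣

-- Ordinals (Brouwer trees); olim I g denotes sup_{i ∈ I} g i.

data Ord : Set₁ where
  ozero : Ord
  osuc  : Ord → Ord
  olim  : (I : Set) → (I → Ord) → Ord

PosNbr : (G : Graph) → (V G → Card) → V G → Set
PosNbr G f x = Σ (V G) (λ y → T (E G x y) × Pos (f y))

data Obs : Ord → (G : Graph) → (V G → Card) → Set₁ where
  obs-zero : ∀ {G f} → InC G f → (x : V G) → Pos (f x)
           → (∀ y → T (E G x y) → f y ≡ fin 0)
           → Obs ozero G f
  obs-sup  : ∀ {G f} → InC G f → (x : V G) → Pos (f x)
           → (β : PosNbr G f x → Ord)
           → (∀ (p : PosNbr G f x) →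
                Obs (β p) (_-edge_,_ G x (proj₁ p)) (fxy G f x (proj₁ p)))
           → Obs (olim (PosNbr G f x) (λ p → osuc (β p))) G f

-- Properties of pairs (G,f).  P(G,f) means (G,f) ∈ 𝒞 and P G f.

Property : Set₂
Property = (G : Graph) → (V G → Card) → Set₁

Holds : Property → (G : Graph) → (V G → Card) → Set₁
Holds P G f = InC G f × P G f

Hereditary : Property → Set₁
Hereditary P = ∀ (G : Graph) (f : V G → Card) → Holds P G f →
  ∀ (x : V G) → Pos (f x) →
    Σ (V G) (λ y → Pos (f y) × T (E G x y) ×
      Holds P (_-edge_,_ G x y) (fxy G f x y))

NotObs : Property
NotObs G f = ∀ (α : Ord) → ¬ Obs α G f

P₂ : (G : Graph) → (V G → Card) → Set₁
P₂ = Holds NotObs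

LEM : Set₂
LEM = (A : Set₁) → Dec A

-- Part (ii) is an induction on obstructions: at the vertex x witnessing an α-obstruction, a
-- hereditary property offers an edge xy along which it survives, and removing xy leaves a
-- β-obstruction with β < α; at a 0-obstruction no such edge exists since all neighbours have
-- f = 0. Part (i) is excluded middle: if every admissible edge xy at x left an obstruction,
-- x would witness that (G,f) is itself an obstruction. The perfect-factor case is (ii) for the
-- property of having a perfect f-factor, which is hereditary: delete an edge of the factor at x.
-- Deleting a neighbour of infinite degree κ keeps κ ≤ the new degree because infinite sets are
-- Dedekind-infinite (Hilbert's hotel), which again uses excluded middle.

module Submission where

open import Defs
open import Level using (Lift; lift; lower)
open import Data.Nat using (ℕ; zero; suc; _≤_; _<_; z≤n; s≤s)
open import Data.Nat.Properties using (<-cmp; m≤n⇒m<n∨m≡n; suc-injective)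
open import Data.Fin using (Fin; zero; suc; punchIn; punchOut)
open import Data.Fin.Properties
  using (punchIn-injective; punchInᵢ≢i; punchIn-punchOut; punchOut-punchIn; punchOut-cong)
  renaming (suc-injective to Fin-suc-injective)
open import Data.Vec.Functional using (_∷_)
open import Data.Bool using (Bool; true; false; _∧_; not; T)
open import Data.Bool.Properties using (T-∧; T-irrelevant; ∨-identityʳ; ∨-zeroʳ; ∧-identityʳ)
open import Data.Empty using (⊥-elim)
open import Data.Product using (Σ; _×_; _,_; proj₁; proj₂)
open import Data.Sum using (inj₁; inj₂)
open import Relation.Binary.Definitions using (DecidableEquality; tri<; tri≈; tri>)
open import Relation.Binary.PropositionalEquality
open import Relation.Nullary using (¬_; Dec; yes; no)
open import Relation.Nullary.Decidable
  using (⌊_⌋; map′; decidable-stable; isYes≗does; dec-true; dec-false; toWitnessFalse; fromWitnessFalse)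
open import Function using (_∘_; Injective)
open import Function.Bundles using (_↔_; _↣_; Inverse; Injection; Equivalence; mk↣; mk↔ₛ′)
open import Function.Properties.Inverse using (↔⇒↣)
open import Function.Construct.Composition using (_↣-∘_; _↔-∘_)
open import Function.Construct.Identity using (↣-id)

module Classical (lem : LEM) where

  decide : (X : Set) → Dec X
  decide X = map′ lower lift (lem (Lift _ X))

  ¬¬-elim : {X : Set} → ¬ ¬ X → X
  ¬¬-elim {X} = decidable-stable (decide X)

  ¬¬-elim₁ : {X : Set₁} → ¬ ¬ X → X
  ¬¬-elim₁ {X} = decidable-stable (lem X)

module DedekindInfinite (lem : LEM) {A : Set} (A-infinite : Infinite A) where
  open Classical lem

  inhabited : A
  inhabited = ¬¬-elim λ ¬a → A-infinite 0
    (mk↔ₛ′ (λ a → ⊥-elim (¬a a)) (λ ()) (λ ()) (λ a → ⊥-elim (¬a a)))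

  fresh : ∀ {n} (s : Fin n → A) → Injective _≡_ _≡_ s → Σ A (λ a → ∀ i → s i ≢ a)
  fresh {n} s s-injective = ¬¬-elim λ ∄a →
    A-infinite n (covering↔ λ a → ¬¬-elim λ ∄i → ∄a (a , λ i si≡a → ∄i (i , si≡a)))
    where
    covering↔ : (∀ a → Σ (Fin n) (λ i → s i ≡ a)) → A ↔ Fin n
    covering↔ preimage = mk↔ₛ′ (proj₁ ∘ preimage) s
      (λ i → s-injective (proj₂ (preimage (s i)))) (proj₂ ∘ preimage)

  module _ (a₀ : A) where

    -- prefix n = (seq n , … , seq 1 , seq 0 = a₀), each entry fresh for the later ones.
    prefix : (n : ℕ) → Fin (suc n) → A
    prefix-injective : ∀ n → Injective _≡_ _≡_ (prefix n)
    next : (n : ℕ) → Σ A (λ a → ∀ i → prefix n i ≢ a)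

    prefix zero _ = a₀
    prefix (suc n) = proj₁ (next n) ∷ prefix n

    prefix-injective zero {zero} {zero} _ = refl
    prefix-injective (suc n) {zero}  {zero}  _ = refl
    prefix-injective (suc n) {zero}  {suc j} e = ⊥-elim (proj₂ (next n) j (sym e))
    prefix-injective (suc n) {suc i} {zero}  e = ⊥-elim (proj₂ (next n) i e)
    prefix-injective (suc n) {suc i} {suc j} e = cong suc (prefix-injective n e)

    next n = fresh (prefix n) (prefix-injective n)

    seq : ℕ → A
    seq n = prefix n zero

    seq∈prefix : ∀ {m n} → m ≤ n → Σ (Fin (suc n)) (λ i → prefix n i ≡ seq m)
    seq∈prefix {n = zero} z≤n = zero , refl
    seq∈prefix {m} {suc n} m≤1+n with m≤n⇒m<n∨m≡n m≤1+n
    ... | inj₂ refl = zero , refl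
    ... | inj₁ (s≤s m≤n) = let i , prefix≡seq = seq∈prefix m≤n in suc i , prefix≡seq

    seq-fresh : ∀ {m n} → m < n → seq m ≢ seq n
    seq-fresh {n = suc n} (s≤s m≤n) seq≡ =
      let i , prefix≡seq = seq∈prefix m≤n in proj₂ (next n) i (trans prefix≡seq seq≡)

    seq-injective : Injective _≡_ _≡_ seq
    seq-injective {m} {n} seq≡ with <-cmp m n
    ... | tri< m<n _ _ = ⊥-elim (seq-fresh m<n seq≡)
    ... | tri≈ _ m≡n _ = m≡n
    ... | tri> _ _ n<m = ⊥-elim (seq-fresh n<m (sym seq≡))

    InSeq : A → Set
    InSeq a = Σ ℕ (λ k → seq k ≡ a)

    -- Hilbert's hotel: move every guest seq k to room seq (suc k), freeing room a₀ = seq 0.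
    shift-by : (a : A) → Dec (InSeq a) → A
    shift-by a (yes (k , _)) = seq (suc k)
    shift-by a (no _)        = a

    shift : A → A
    shift a = shift-by a (decide (InSeq a))

    shift-injective : Injective _≡_ _≡_ shift
    shift-injective {a} {b} = by-cases (decide (InSeq a)) (decide (InSeq b))
      where
      by-cases : ∀ da db → shift-by a da ≡ shift-by b db → a ≡ b
      by-cases (yes (k , refl)) (yes (m , refl)) e = cong seq (suc-injective (seq-injective e))
      by-cases (yes (k , _))    (no b∉)          e = ⊥-elim (b∉ (suc k , e))
      by-cases (no a∉)          (yes (m , _))    e = ⊥-elim (a∉ (suc m , sym e))
      by-cases (no _)           (no _)           e = e

    shift-avoids : ∀ a → shift a ≢ a₀
    shift-avoids a = by-cases (decide (InSeq a))
      where
      by-cases : ∀ da → shift-by a da ≢ a₀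
      by-cases (yes (k , _)) e with () ← seq-injective {0} {suc k} (sym e)
      by-cases (no a∉)       e = a∉ (0 , sym e)

    punctured↣ : Σ (A ↣ A) (λ k → ∀ a → Injection.to k a ≢ a₀)
    punctured↣ = mk↣ shift-injective , shift-avoids

punctured↣ : LEM → ∀ c (i : ⟦ c ⟧) → Σ (⟦ dec1 c ⟧ ↣ ⟦ c ⟧) (λ k → ∀ d → Injection.to k d ≢ i)
punctured↣ lem (fin (suc n)) i = mk↣ (punchIn-injective i _ _) , punchInᵢ≢i i
punctured↣ lem (inf A A-infinite) a₀ = DedekindInfinite.punctured↣ lem A-infinite a₀

dec1↣ : ∀ c → ⟦ dec1 c ⟧ ↣ ⟦ c ⟧
dec1↣ (fin zero)    = ↣-id _
dec1↣ (fin (suc n)) = mk↣ Fin-suc-injective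
dec1↣ (inf A _)     = ↣-id A

module Subsets {V : Set} where

  ⟪_⟫ : (V → Bool) → Set
  ⟪ P ⟫ = Σ V (λ u → T (P u))

  ⟪⟫-≡ : ∀ {P u v} {p : T (P u)} {q : T (P v)} → u ≡ v → _≡_ {A = ⟪ P ⟫} (u , p) (v , q)
  ⟪⟫-≡ {p = p} {q} refl = cong (_ ,_) (T-irrelevant p q)

  ⟪⟫-cong : ∀ {P Q} → (∀ u → P u ≡ Q u) → ⟪ P ⟫ ↔ ⟪ Q ⟫
  ⟪⟫-cong P≗Q = mk↔ₛ′
    (λ (u , p) → u , subst T (P≗Q u) p) (λ (u , q) → u , subst T (sym (P≗Q u)) q)
    (λ _ → ⟪⟫-≡ refl) (λ _ → ⟪⟫-≡ refl)

  record _≐_∖_ (Q P : V → Bool) (y : V) : Set where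
    field
      sub   : ∀ {u} → T (Q u) → T (P u)
      avoid : ∀ {u} → T (Q u) → u ≢ y
      cover : ∀ {u} → T (P u) → u ≢ y → T (Q u)

  module _ {Q P : V → Bool} {y : V} (Q≐P∖y : Q ≐ P ∖ y) where
    open _≐_∖_ Q≐P∖y

    corestrict : ∀ {D : Set} (g : D ↣ ⟪ P ⟫) → (∀ d → proj₁ (Injection.to g d) ≢ y) → D ↣ ⟪ Q ⟫
    corestrict g g≢y = mk↣ {to = λ d → proj₁ (to d) , cover (proj₂ (to d)) (g≢y d)}
      (λ e → injective (⟪⟫-≡ (cong proj₁ e)))
      where open Injection g using (to; injective)

    ≤-remove : LEM → ∀ c → c ≤∣ ⟪ P ⟫ ∣ → dec1 c ≤∣ ⟪ Q ⟫ ∣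
    ≤-remove lem c g with Classical.decide lem (Σ ⟦ c ⟧ λ i → proj₁ (Injection.to g i) ≡ y)
    ... | yes (i , gi≡y) = let k , k≢i = punctured↣ lem c i in
      corestrict (g ↣-∘ k) λ d e → k≢i d (Injection.injective g (⟪⟫-≡ (trans e (sym gi≡y))))
    ... | no ∄i = corestrict (g ↣-∘ dec1↣ c) λ d e → ∄i (_ , e)

    ↔-remove : ∀ {n} → T (P y) → Fin (suc n) ↔ ⟪ P ⟫ → Fin n ↔ ⟪ Q ⟫
    ↔-remove {n} Py e = mk↔ₛ′ to′ from′ to′∘from′ from′∘to′
      where
      open Inverse e using (to; from; strictlyInverseˡ; strictlyInverseʳ)
      i₀ : Fin (suc n)
      i₀ = from (y , Py)

      to-punchIn≢y : ∀ j → proj₁ (to (punchIn i₀ j)) ≢ y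
      to-punchIn≢y j ≡y = punchInᵢ≢i i₀ j (trans (sym (strictlyInverseʳ _)) (cong from (⟪⟫-≡ ≡y)))

      from≢i₀ : ∀ (z : ⟪ Q ⟫) → i₀ ≢ from (proj₁ z , sub (proj₂ z))
      from≢i₀ (u , Qu) i₀≡ = avoid Qu (sym (cong proj₁
        (trans (sym (strictlyInverseˡ _)) (trans (cong to i₀≡) (strictlyInverseˡ _)))))

      to′ : Fin n → ⟪ Q ⟫
      to′ j = proj₁ (to (punchIn i₀ j)) , cover (proj₂ (to (punchIn i₀ j))) (to-punchIn≢y j)

      from′ : ⟪ Q ⟫ → Fin n
      from′ z = punchOut (from≢i₀ z)

      to′∘from′ : ∀ z → to′ (from′ z) ≡ z
      to′∘from′ z = ⟪⟫-≡ (cong proj₁ (trans (cong to (punchIn-punchOut (from≢i₀ z))) (strictlyInverseˡ _)))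

      from′∘to′ : ∀ j → from′ (to′ j) ≡ j
      from′∘to′ j = trans (punchOut-cong i₀ (trans (cong from (⟪⟫-≡ refl)) (strictlyInverseʳ _)))
                          (punchOut-punchIn i₀)

open Subsets

-- Exact size for finite c; for infinite c only an embedding, since removing a point from an
-- infinite set S with ⟦ c ⟧ ↔ S would need ⟦ c ⟧ ↔ ⟦ c ⟧ minus a point.
_≈∣_∣ : Card → Set → Set
fin n   ≈∣ S ∣ = Fin n ↔ S
inf A _ ≈∣ S ∣ = A ↣ S

=⇒≈ : ∀ c {S} → c =∣ S ∣ → c ≈∣ S ∣
=⇒≈ (fin n)   e = e
=⇒≈ (inf A _) e = ↔⇒↣ e

≤-cong : ∀ c {S S′} → S ↔ S′ → c ≤∣ S ∣ → c ≤∣ S′ ∣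
≤-cong c S↔S′ g = ↔⇒↣ S↔S′ ↣-∘ g

≈-cong : ∀ c {S S′} → S ↔ S′ → c ≈∣ S ∣ → c ≈∣ S′ ∣
≈-cong (fin n)   S↔S′ e = S↔S′ ↔-∘ e
≈-cong (inf A _) S↔S′ g = ↔⇒↣ S↔S′ ↣-∘ g

≈-positive : ∀ c {S} → c ≈∣ S ∣ → S → Pos c
≈-positive (fin zero)    e s with () ← Inverse.from e s
≈-positive (fin (suc n)) e s = _
≈-positive (inf A _)     g s = _

≈-inhabited : LEM → ∀ c {S} → Pos c → c ≈∣ S ∣ → S
≈-inhabited lem (fin (suc n))      _ e = Inverse.to e zero
≈-inhabited lem (inf A A-infinite) _ g = Injection.to g (DedekindInfinite.inhabited lem A-infinite)

≈-remove : LEM → ∀ {V : Set} {Q P : V → Bool} {y} → Q ≐ P ∖ y → T (P y) →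
           ∀ c → c ≈∣ ⟪ P ⟫ ∣ → dec1 c ≈∣ ⟪ Q ⟫ ∣
≈-remove lem Q≐P∖y Py (fin zero)    e with () ← Inverse.from e (_ , Py)
≈-remove lem Q≐P∖y Py (fin (suc n)) e = ↔-remove Q≐P∖y Py e
≈-remove lem Q≐P∖y Py (inf A i)     g = ≤-remove Q≐P∖y lem (inf A i) g

⌊⌋-yes : ∀ {A : Set} (a? : Dec A) → A → ⌊ a? ⌋ ≡ true
⌊⌋-yes a? a = trans (isYes≗does a?) (dec-true a? a)

⌊⌋-no : ∀ {A : Set} (a? : Dec A) → ¬ A → ⌊ a? ⌋ ≡ false
⌊⌋-no a? ¬a = trans (isYes≗does a?) (dec-false a? ¬a)

module EdgeDeletion (G : Graph) where

  private
    Vertex : Set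
    Vertex = V G

    Rel : Set
    Rel = Vertex → Vertex → Bool

    _≟V_ : DecidableEquality Vertex
    _≟V_ = G ._≟_

  edge⇒≢ : ∀ {x y} → T (E G x y) → x ≢ y
  edge⇒≢ {x} xy∈E refl = subst T (E-irr G x) xy∈E

  -- deleteEdge (E G) x y is definitionally E (G -edge x , y).
  deleteEdge : Rel → Vertex → Vertex → Rel
  deleteEdge F x y u v = F u v ∧ not (isPair G x y u v)

  deleteEdge-sym : ∀ {F} → (∀ u v → F u v ≡ F v u) →
                   ∀ x y u v → deleteEdge F x y u v ≡ deleteEdge F x y v u
  deleteEdge-sym F-sym x y u v = cong₂ (λ a b → a ∧ not b) (F-sym u v) (isPair-sym G x y u v)

  deleteEdge-mono : ∀ {F F′} → (∀ u v → T (F u v) → T (F′ u v)) →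
                    ∀ x y u v → T (deleteEdge F x y u v) → T (deleteEdge F′ x y u v)
  deleteEdge-mono F⊆F′ x y u v uv∈F =
    let u∈F , ¬pair = Equivalence.to T-∧ uv∈F in Equivalence.from T-∧ (F⊆F′ u v u∈F , ¬pair)

  ∧-not-≟⇒≐∖ : ∀ {Q P : Vertex → Bool} {y} → (∀ u → Q u ≡ P u ∧ not ⌊ u ≟V y ⌋) → Q ≐ P ∖ y
  ∧-not-≟⇒≐∖ {Q} {P} {y} Q≗ = record
    { sub   = λ {u} Qu → proj₁ (split u Qu)
    ; avoid = λ {u} Qu → toWitnessFalse (proj₂ (split u Qu))
    ; cover = λ {u} Pu u≢y → subst T (sym (Q≗ u)) (Equivalence.from T-∧ (Pu , fromWitnessFalse u≢y))
    }
    where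
    split : ∀ u → T (Q u) → T (P u) × T (not ⌊ u ≟V y ⌋)
    split u Qu = Equivalence.to T-∧ (subst T (Q≗ u) Qu)

  module _ {x y : Vertex} (x≢y : x ≢ y) where

    deleteEdge-at-x : ∀ F → deleteEdge F x y x ≐ F x ∖ y
    deleteEdge-at-x F = ∧-not-≟⇒≐∖ λ u → cong (λ b → F x u ∧ not b) (pair-at-x u)
      where
      pair-at-x : ∀ u → isPair G x y x u ≡ ⌊ u ≟V y ⌋
      pair-at-x u rewrite ⌊⌋-yes (x ≟V x) refl | ⌊⌋-no (x ≟V y) x≢y = ∨-identityʳ _

    deleteEdge-at-y : ∀ F → deleteEdge F x y y ≐ F y ∖ x
    deleteEdge-at-y F = ∧-not-≟⇒≐∖ λ u → cong (λ b → F y u ∧ not b) (pair-at-y u)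
      where
      pair-at-y : ∀ u → isPair G x y y u ≡ ⌊ u ≟V x ⌋
      pair-at-y u rewrite ⌊⌋-no (y ≟V x) (x≢y ∘ sym) | ⌊⌋-yes (y ≟V y) refl = refl

  deleteEdge-elsewhere : ∀ F {x y v} → v ≢ x → v ≢ y → ∀ u → deleteEdge F x y v u ≡ F v u
  deleteEdge-elsewhere F {x} {y} {v} v≢x v≢y u
    rewrite ⌊⌋-no (v ≟V x) v≢x | ⌊⌋-no (v ≟V y) v≢y = ∧-identityʳ (F v u)

  fxy-at-x : ∀ f {x y} → fxy G f x y x ≡ dec1 (f x)
  fxy-at-x f {x} rewrite ⌊⌋-yes (x ≟V x) refl = refl

  fxy-at-y : ∀ f {x y} → fxy G f x y y ≡ dec1 (f y)
  fxy-at-y f {x} {y} rewrite ⌊⌋-yes (y ≟V y) refl | ∨-zeroʳ ⌊ y ≟V x ⌋ = refl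

  fxy-elsewhere : ∀ f {x y v} → v ≢ x → v ≢ y → fxy G f x y v ≡ f v
  fxy-elsewhere f {x} {y} {v} v≢x v≢y rewrite ⌊⌋-no (v ≟V x) v≢x | ⌊⌋-no (v ≟V y) v≢y = refl

  module _ (R : Card → Set → Set)
           (R-remove : ∀ {Q P : Vertex → Bool} {y} → Q ≐ P ∖ y → T (P y) →
                       ∀ c → R c ⟪ P ⟫ → R (dec1 c) ⟪ Q ⟫)
           (R-cong : ∀ c {S S′} → S ↔ S′ → R c S → R c S′) where

    deleteEdge-preserves : ∀ {f F x y} → x ≢ y → T (F x y) → T (F y x) →
      (∀ v → R (f v) ⟪ F v ⟫) → ∀ v → R (fxy G f x y v) ⟪ deleteEdge F x y v ⟫
    deleteEdge-preserves {f} {F} {x} {y} x≢y xy∈F yx∈F R-F v = by-cases (v ≟V x) (v ≟V y)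
      where
      by-cases : Dec (v ≡ x) → Dec (v ≡ y) → R (fxy G f x y v) ⟪ deleteEdge F x y v ⟫
      by-cases (yes refl) _ = subst (λ c → R c _) (sym (fxy-at-x f))
        (R-remove (deleteEdge-at-x x≢y F) xy∈F (f x) (R-F x))
      by-cases (no _) (yes refl) = subst (λ c → R c _) (sym (fxy-at-y f))
        (R-remove (deleteEdge-at-y x≢y F) yx∈F (f y) (R-F y))
      by-cases (no v≢x) (no v≢y) = subst (λ c → R c _) (sym (fxy-elsewhere f v≢x v≢y))
        (R-cong (f v) (⟪⟫-cong (λ u → sym (deleteEdge-elsewhere F v≢x v≢y u))) (R-F v))

open EdgeDeletion

InC-deleteEdge : LEM → ∀ G f {x y} → InC G f → T (E G x y) → InC (_-edge_,_ G x y) (fxy G f x y)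
InC-deleteEdge lem G f inc xy∈E =
  deleteEdge-preserves G _≤∣_∣ (λ Q≐P∖y _ → ≤-remove Q≐P∖y lem) ≤-cong
    (edge⇒≢ G xy∈E) xy∈E (subst T (E-sym G _ _) xy∈E) inc

hereditary⇒¬Obs : ∀ {P} → Hereditary P → ∀ {α G f} → Holds P G f → ¬ Obs α G f
hereditary⇒¬Obs her h (obs-zero _ x fx>0 nbrs-zero) with her _ _ h x fx>0
... | y , fy>0 , xy∈E , _ = subst Pos (nbrs-zero y xy∈E) fy>0
hereditary⇒¬Obs her h (obs-sup _ x fx>0 _ obs) with her _ _ h x fx>0
... | y , fy>0 , xy∈E , h′ = hereditary⇒¬Obs her h′ (obs (y , xy∈E , fy>0))

hereditary⇒P₂ : ∀ P → Hereditary P → ∀ G f → Holds P G f → P₂ G f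
hereditary⇒P₂ P her G f h = proj₁ h , λ α → hereditary⇒¬Obs her h

P₂-hereditary : LEM → Hereditary NotObs
P₂-hereditary lem G f (inc , ¬obs) x fx>0 =
  let y , fy>0 , xy∈E , ¬obs′ = good-neighbour in
  y , fy>0 , xy∈E , InC-deleteEdge lem G f inc xy∈E , ¬obs′
  where
  open Classical lem

  GoodNeighbour : Set₁
  GoodNeighbour = Σ (V G) λ y → Pos (f y) × T (E G x y) × NotObs (_-edge_,_ G x y) (fxy G f x y)

  obstruction : ¬ GoodNeighbour → (p : PosNbr G f x) →
                Σ Ord λ β → Obs β (_-edge_,_ G x (proj₁ p)) (fxy G f x (proj₁ p))
  obstruction ∄y (y , xy∈E , fy>0) = ¬¬-elim₁ λ ∄β → ∄y (y , fy>0 , xy∈E , λ β o → ∄β (β , o))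

  good-neighbour : GoodNeighbour
  good-neighbour = ¬¬-elim₁ λ ∄y → ¬obs _
    (obs-sup inc x fx>0 (λ p → proj₁ (obstruction ∄y p)) (λ p → proj₂ (obstruction ∄y p)))

record WeakPerfectFactor (G : Graph) (f : V G → Card) : Set₁ where
  field
    F      : V G → V G → Bool
    F-sym  : ∀ x y → F x y ≡ F y x
    F-sub  : ∀ x y → T (F x y) → T (E G x y)
    degree : ∀ x → f x ≈∣ Nbhd F x ∣

perfect⇒weak : ∀ {G f} → PerfectFactor G f → WeakPerfectFactor G f
perfect⇒weak {G} {f} pf = record
  { F = F ; F-sym = F-sym ; F-sub = F-sub ; degree = λ x → =⇒≈ (f x) (perfect x) }
  where open PerfectFactor pf

weakPerfectFactor-hereditary : LEM → Hereditary WeakPerfectFactor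
weakPerfectFactor-hereditary lem G f (inc , W) x fx>0 =
  y , ≈-positive (f y) (degree y) (x , yx∈F) , xy∈E , InC-deleteEdge lem G f inc xy∈E , W′
  where
  open WeakPerfectFactor W
  neighbour : Nbhd F x
  neighbour = ≈-inhabited lem (f x) fx>0 (degree x)

  y : V G
  y = proj₁ neighbour

  xy∈F : T (F x y)
  xy∈F = proj₂ neighbour

  yx∈F : T (F y x)
  yx∈F = subst T (F-sym x y) xy∈F

  xy∈E : T (E G x y)
  xy∈E = F-sub x y xy∈F

  W′ : WeakPerfectFactor (_-edge_,_ G x y) (fxy G f x y)
  W′ = record
    { F      = deleteEdge G F x y
    ; F-sym  = deleteEdge-sym G F-sym x y
    ; F-sub  = deleteEdge-mono G F-sub x y
    ; degree = deleteEdge-preserves G _≈∣_∣ (≈-remove lem) ≈-cong (edge⇒≢ G xy∈E) xy∈F yx∈F degree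
    }

lemma1 : LEM →
    Hereditary NotObs
    × (∀ (P : Property) → Hereditary P →
         ∀ (G : Graph) (f : V G → Card) → Holds P G f → P₂ G f)
    × (∀ (G : Graph) (f : V G → Card) → InC G f → PerfectFactor G f → P₂ G f)
lemma1 lem =
    P₂-hereditary lem
  , hereditary⇒P₂
  , λ G f inc pf →
      hereditary⇒P₂ WeakPerfectFactor (weakPerfectFactor-hereditary lem) G f (inc , perfect⇒weak pf)
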